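{- Let $(z_n)_{n\ge 2}$ be integers with $z_2\ge 3$ and $z_n\ge 2$ for all $n\ge 3$, and define $x_1=1$ and $x_n=\prod_{j=2}^{n} z_j^{2^{n-j}}$ for $n\ge 2$. Let $$S=\sum_{j=1}^{\infty}\frac{1}{x_j}=1+\sum_{j=2}^{\infty}\frac{1}{z_2^{2^{j-2}}z_3^{2^{j-3}}\cdots z_j}.$$ For $n\ge 3$ put $\ell_n=3\cdot 2^{n-2}-1$ and define finite sequences $(a_j^{(n)})_{j=0}^{\ell_n-1}$ recursively by $$(a_0^{(3)},a_1^{(3)},a_2^{(3)},a_3^{(3)},a_4^{(3)})=(1,\ z_2-1,\ 1,\ z_3-1,\ z_2),$$ and for $n\ge3$: $a_j^{(n+1)}=a_j^{(n)}$ for $j=0,\ldots,\ell_n-1$; $a_{\ell_n}^{(n+1)}=z_{n+1}-1$, $a_{\ell_n+1}^{(n+1)}=1$, $a_{\ell_n+2}^{(n+1)}=a_{\ell_n-1}^{(n)}-1$; and $a_j^{(n+1)}=a_{2\ell_n-j+1}^{(n)}$ for $j=\ell_n+3,\ldots,2\ell_n$. For each $j\ge 0$ let $a_j=\lim_{n\to\infty}a_j^{(n)}$ (the sequence $a_j^{(n)}$ is eventually constant in $n$). Then $S$ has the (infinite, simple) continued fraction expansion $$S=[a_0;a_1,a_2,\ldots]=[1;\ z_2-1,\ 1,\ z_3-1,\ z_2,\ z_4-1,\ 1,\ \ldots].$$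
   Context: $[a_0;a_1,a_2,\ldots]$ denotes the infinite continued fraction $a_0+\cfrac{1}{a_1+\cfrac{1}{a_2+\cdots}}$, i.e. the limit of the finite continued fractions $[a_0;a_1,\ldots,a_m]$ as $m\to\infty$. -}

module Defs where

open import Data.Nat as ℕ using (ℕ; zero; suc; _∸_; _<ᵇ_; _≡ᵇ_; _≤ᵇ_)
open import Data.Integer as ℤ using (ℤ; +_)
open import Data.Rational as ℚ using (ℚ; 0ℚ; _/_)
open import Data.Rational.Properties using (_≟_)
open import Data.List using (List; []; _∷_; foldr; map; upTo)
open import Data.Bool using (if_then_else_)
open import Relation.Nullary using (yes; no)

toℚ : ℤ → ℚ
toℚ k = k / 1

-- reciprocal on ℚ, made total by sending 0 to 0 (only ever applied to
-- nonzero arguments under the theorem's hypotheses)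
recip : ℚ → ℚ
recip q with q ≟ 0ℚ
... | yes _   = 0ℚ
... | no q≢0 = ℚ.1/_ q {{ℚ.≢-nonZero q≢0}}

-- x_1 = 1, x_n = ∏_{j=2}^{n} z_j^(2^(n-j)) for n ≥ 2  (x_0 is unused junk)
x : (ℕ → ℤ) → ℕ → ℤ
x z zero = + 1
x z (suc zero) = + 1
x z (suc (suc k)) =
  foldr ℤ._*_ (+ 1)
    (map (λ j → z j ℤ.^ (2 ℕ.^ (suc (suc k) ∸ j))) (map (2 ℕ.+_) (upTo (suc k))))

sumFrom1 : (ℕ → ℚ) → ℕ → ℚ
sumFrom1 f zero = 0ℚ
sumFrom1 f (suc m) = sumFrom1 f m ℚ.+ f (suc m)

partialSum : (ℕ → ℤ) → ℕ → ℚ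
partialSum z = sumFrom1 (λ j → recip (toℚ (x z j)))

ell : ℕ → ℕ
ell n = 3 ℕ.* 2 ℕ.^ (n ∸ 2) ∸ 1

-- (a^(3)_j)_{j=0..4} = (1, z_2 - 1, 1, z_3 - 1, z_2); 0 outside the range (junk)
base : (ℕ → ℤ) → ℕ → ℤ
base z 0 = + 1
base z 1 = z 2 ℤ.- + 1
base z 2 = + 1
base z 3 = z 3 ℤ.- + 1
base z 4 = z 2
base z _ = + 0

-- A z k j = a^(k+3)_j  (junk value 0 for j ≥ ℓ_{k+3})
A : (ℕ → ℤ) → ℕ → ℕ → ℤ
A z zero j = base z j
A z (suc k) j =
  if j <ᵇ ℓ then A z k j
  else if j ≡ᵇ ℓ then z (suc n) ℤ.- + 1
  else if j ≡ᵇ suc ℓ then + 1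
  else if j ≡ᵇ suc (suc ℓ) then A z k (ℓ ∸ 1) ℤ.- + 1
  else if j ≤ᵇ 2 ℕ.* ℓ then A z k (2 ℕ.* ℓ ℕ.+ 1 ∸ j)
  else + 0
  where
    n : ℕ
    n = k ℕ.+ 3
    ℓ : ℕ
    ℓ = ell n

-- a^(n)_j, meaningful for n ≥ 3 and j < ℓ_n
aSeq : (ℕ → ℤ) → ℕ → ℕ → ℤ
aSeq z n j = A z (n ∸ 3) j

cfEval : List ℤ → ℚ
cfEval [] = 0ℚ
cfEval (b ∷ []) = toℚ b
cfEval (b ∷ bs@(_ ∷ _)) = toℚ b ℚ.+ recip (cfEval bs)

convergent : (ℕ → ℤ) → ℕ → ℚ
convergent a m = cfEval (map a (upTo (suc m)))

{-# OPTIONS --safe #-}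

-- With M a = [[a, 1], [1, 0]], the product of the M aᵢ for [a₀; a₁, …, aₘ] has the
-- numerator and denominator of the continued fraction in its first column and
-- determinant ±1. The recursion defining a⁽ⁿ⁺¹⁾ is the folding lemma: if a⁽ⁿ⁾ has
-- value p/q and determinant −1, appending zₙ₊₁ − 1, 1, (last entry) − 1 and the
-- reversed middle part gives value p/q + 1/(zₙ₊₁ q²) and determinant −1 again.
-- As xₙ₊₁ = zₙ₊₁ xₙ², induction shows that a⁽ⁿ⁾ has value Sₙ and denominator xₙ.
-- A continued fraction with positive partial quotients extending a prefix of
-- denominator q lies within 1/q² of the prefix, so the partial sums Sₘ and the
-- convergents of a (which extend a⁽ⁿ⁾) are both within 1/xₙ² of Sₙ.

module Submission where

open import Defs
open import Data.Nat as ℕ using (ℕ)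
open import Data.Integer as ℤ using (ℤ; +_)
open import Data.Rational as ℚ using (ℚ; 0ℚ)
open import Data.Product using (∃-syntax)
open import Relation.Binary.PropositionalEquality using (_≡_)

open import Algebra.Bundles.Raw using (RawRing)
open import Data.Bool using (true; false; T; if_then_else_)
import Data.Integer.Properties as ℤP
import Data.Integer.Solver as ℤ-Solver
open import Data.Integer.Tactic.RingSolver using (solve-∀)
open import Data.List using (_∷_; applyUpTo; foldr; map)
import Data.List.Properties as ListP
open import Data.Nat using (zero; suc; s≤s; z≤n; _<ᵇ_; _≡ᵇ_)
import Data.Nat.Tactic.RingSolver as ℕ-Ring
import Data.Nat.Properties as ℕP
open import Data.Product using (_,_; proj₁; proj₂)
open import Data.Rational using (1ℚ)
import Data.Rational.Properties as ℚP
open import Data.Rational.Unnormalised as ℚᵘ using (mkℚᵘ; *≡*; *≤*; *<*)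
import Data.Rational.Unnormalised.Properties as ℚᵘP
import Data.Rational.Solver as ℚ-Solver
open import Data.Sum using (_⊎_; inj₁; inj₂)
open import Function using (_∘_)
open import Level using (0ℓ)
open import Relation.Binary.PropositionalEquality
  using (_≢_; refl; sym; trans; cong; cong₂; subst; subst₂; module ≡-Reasoning)
open import Relation.Nullary using (¬_; yes; no)
open import Relation.Nullary.Negation using (contradiction)

record Mat (R : Set) : Set where
  constructor mat
  field
    m11 m12 m21 m22 : R
open Mat

module MatrixAlgebra (R : RawRing 0ℓ 0ℓ) where
  open RawRing R

  infixr 7 _⊗_
  _⊗_ : Mat Carrier → Mat Carrier → Mat Carrier
  mat a b c d ⊗ mat e f g h =
    mat (a * e + b * g) (a * f + b * h) (c * e + d * g) (c * f + d * h)

  I : Mat Carrier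
  I = mat 1# 0# 0# 1#

  M : Carrier → Mat Carrier
  M a = mat a 1# 1# 0#

  transpose : Mat Carrier → Mat Carrier
  transpose (mat a b c d) = mat a c b d

  det : Mat Carrier → Carrier
  det (mat a b c d) = a * d + - (b * c)

  -- cfMatrix f (m + 1) = [[pₘ, pₘ₋₁], [qₘ, qₘ₋₁]] for the convergents pᵢ/qᵢ of [f 0; f 1, …]
  cfMatrix : (ℕ → Carrier) → ℕ → Mat Carrier
  cfMatrix f zero = I
  cfMatrix f (suc n) = M (f 0) ⊗ cfMatrix (f ∘ suc) n

  -- If W is the matrix of w₁, …, wₖ, then folded W l is that of [1; w₁, …, wₖ, l] and
  -- unfolded W l x that of [1; w₁, …, wₖ, l, x − 1, 1, l − 1, wₖ, …, w₁].
  folded : Mat Carrier → Carrier → Mat Carrier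
  folded W l = M 1# ⊗ W ⊗ M l

  unfolded : Mat Carrier → Carrier → Carrier → Mat Carrier
  unfolded W l x = folded W l ⊗ M (x + - 1#) ⊗ M 1# ⊗ M (l + - 1#) ⊗ transpose W

  initial : Carrier → Carrier → Mat Carrier
  initial z₂ z₃ = M 1# ⊗ M (z₂ + - 1#) ⊗ M 1# ⊗ M (z₃ + - 1#) ⊗ M z₂ ⊗ I

open MatrixAlgebra ℤ.+-*-rawRing
open import Data.Integer using (_+_; _*_; -_; _≤_; _<_)

-- Matrix identities over ℤ are proved by running the ring solver on the same
-- matrix expressions built over the solver's polynomial syntax.
polynomialRawRing : ℕ → RawRing 0ℓ 0ℓ
polynomialRawRing n = record
  { Carrier = Polynomial n ; _≈_ = _≡_ ; _+_ = _:+_ ; _*_ = _:*_ ; -_ = :-_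
  ; 0# = con (+ 0) ; 1# = con (+ 1) }
  where open ℤ-Solver.+-*-Solver

module Symbolic {n : ℕ} = MatrixAlgebra (polynomialRawRing n)

mat-cong : ∀ {a b c d a′ b′ c′ d′ : ℤ} →
  a ≡ a′ → b ≡ b′ → c ≡ c′ → d ≡ d′ → mat a b c d ≡ mat a′ b′ c′ d′
mat-cong refl refl refl refl = refl

⊗-assoc : ∀ A B C → (A ⊗ B) ⊗ C ≡ A ⊗ B ⊗ C
⊗-assoc (mat a b c d) (mat e f g h) (mat i j k l) =
  mat-cong (entry a b e f g h i k) (entry a b e f g h j l) (entry c d e f g h i k) (entry c d e f g h j l)
  where
    entry : ∀ a b e f g h i k →
      (a * e + b * g) * i + (a * f + b * h) * k ≡ a * (e * i + f * k) + b * (g * i + h * k)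
    entry = solve-∀

⊗-identityˡ : ∀ A → I ⊗ A ≡ A
⊗-identityˡ (mat a b c d) = mat-cong (entry a c) (entry b d) (entry′ a c) (entry′ b d)
  where
    entry : ∀ a c → + 1 * a + + 0 * c ≡ a
    entry = solve-∀
    entry′ : ∀ a c → + 0 * a + + 1 * c ≡ c
    entry′ = solve-∀

⊗-identityʳ : ∀ A → A ⊗ I ≡ A
⊗-identityʳ (mat a b c d) = mat-cong (entry a b) (entry′ a b) (entry c d) (entry′ c d)
  where
    entry : ∀ a b → a * + 1 + b * + 0 ≡ a
    entry = solve-∀
    entry′ : ∀ a b → a * + 0 + b * + 1 ≡ b
    entry′ = solve-∀

transpose-⊗ : ∀ A B → transpose (A ⊗ B) ≡ transpose B ⊗ transpose A
transpose-⊗ (mat a b c d) (mat e f g h) =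
  mat-cong (entry a b e g) (entry c d e g) (entry a b f h) (entry c d f h)
  where
    entry : ∀ a b e g → a * e + b * g ≡ e * a + g * b
    entry = solve-∀

det-⊗ : ∀ A B → det (A ⊗ B) ≡ det A * det B
det-⊗ (mat a b c d) (mat e f g h) = solve 8 (λ a b c d e f g h →
    Symbolic.det (mat a b c d Symbolic.⊗ mat e f g h) := Symbolic.det (mat a b c d) :* Symbolic.det (mat e f g h))
  refl a b c d e f g h
  where open ℤ-Solver.+-*-Solver

det-M : ∀ a → det (M a) ≡ - + 1
det-M = solve 1 (λ a → Symbolic.det (Symbolic.M a) := :- con (+ 1)) refl
  where open ℤ-Solver.+-*-Solver

cfMatrix-cong : ∀ n {f g : ℕ → ℤ} → (∀ i → i ℕ.< n → f i ≡ g i) → cfMatrix f n ≡ cfMatrix g n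
cfMatrix-cong zero f≗g = refl
cfMatrix-cong (suc n) f≗g =
  cong₂ (λ u B → M u ⊗ B) (f≗g 0 (s≤s z≤n)) (cfMatrix-cong n (λ i i<n → f≗g (suc i) (s≤s i<n)))

cfMatrix-++ : ∀ m n f → cfMatrix f (m ℕ.+ n) ≡ cfMatrix f m ⊗ cfMatrix (λ i → f (m ℕ.+ i)) n
cfMatrix-++ zero n f = sym (⊗-identityˡ (cfMatrix f n))
cfMatrix-++ (suc m) n f =
  trans (cong (M (f 0) ⊗_) (cfMatrix-++ m n (f ∘ suc))) (sym (⊗-assoc (M (f 0)) _ _))

cfMatrix-snoc : ∀ n f → cfMatrix f (suc n) ≡ cfMatrix f n ⊗ M (f n)
cfMatrix-snoc zero f = trans (⊗-identityʳ (M (f 0))) (sym (⊗-identityˡ (M (f 0))))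
cfMatrix-snoc (suc n) f =
  trans (cong (M (f 0) ⊗_) (cfMatrix-snoc n (f ∘ suc))) (sym (⊗-assoc (M (f 0)) _ _))

cfMatrix-reverse : ∀ n f → cfMatrix (λ i → f (n ℕ.∸ suc i)) n ≡ transpose (cfMatrix f n)
cfMatrix-reverse zero f = refl
cfMatrix-reverse (suc n) f = begin
  M (f n) ⊗ cfMatrix (λ i → f (n ℕ.∸ suc i)) n  ≡⟨ cong (M (f n) ⊗_) (cfMatrix-reverse n f) ⟩
  M (f n) ⊗ transpose (cfMatrix f n)            ≡⟨ sym (transpose-⊗ (cfMatrix f n) (M (f n))) ⟩
  transpose (cfMatrix f n ⊗ M (f n))            ≡⟨ cong transpose (sym (cfMatrix-snoc n f)) ⟩
  transpose (cfMatrix f (suc n))                ∎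
  where open ≡-Reasoning

det-cfMatrix : ∀ n f → det (cfMatrix f n) ≡ + 1 ⊎ det (cfMatrix f n) ≡ - + 1
det-cfMatrix zero f = inj₁ refl
det-cfMatrix (suc n) f with det-cfMatrix n (f ∘ suc)
... | inj₁ d≡1  = inj₂ (trans (det-⊗ (M (f 0)) _) (cong₂ _*_ (det-M (f 0)) d≡1))
... | inj₂ d≡-1 = inj₁ (trans (det-⊗ (M (f 0)) _) (cong₂ _*_ (det-M (f 0)) d≡-1))

pos⇒≢0 : ∀ {b} → + 0 < b → b ≢ + 0
pos⇒≢0 0<b b≡0 = ℤP.<⇒≢ 0<b (sym b≡0)

1≤⇒pos : ∀ {a} → + 1 ≤ a → + 0 < a
1≤⇒pos = ℤP.suc[i]≤j⇒i<j

*-pos : ∀ {a b} → + 0 < a → + 0 < b → + 0 < a * b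
*-pos {b = b} 0<a 0<b = ℤP.*-monoʳ-<-pos b {{ℤ.positive 0<b}} 0<a

*-≢0 : ∀ {a b} → a ≢ + 0 → b ≢ + 0 → a * b ≢ + 0
*-≢0 {a} a≢0 b≢0 ab≡0 with ℤP.i*j≡0⇒i≡0∨j≡0 a ab≡0
... | inj₁ a≡0 = a≢0 a≡0
... | inj₂ b≡0 = b≢0 b≡0

nonNeg-* : ∀ {a b} → + 0 ≤ a → + 0 ≤ b → + 0 ≤ a * b
nonNeg-* {a} {b} 0≤a 0≤b = subst (_≤ a * b) (ℤP.*-zeroʳ a) (ℤP.*-monoˡ-≤-nonNeg a {{ℤ.nonNegative 0≤a}} 0≤b)

≤-+-nonNeg : ∀ {a b} → + 0 ≤ b → a ≤ a + b
≤-+-nonNeg {a} {b} 0≤b = ℤP.i≤i+j a b {{ℤ.nonNegative 0≤b}}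

≤-*ˡ : ∀ {f a} → + 1 ≤ f → + 0 ≤ a → a ≤ f * a
≤-*ˡ {f} {a} 1≤f 0≤a = subst (_≤ f * a) (ℤP.*-identityˡ a) (ℤP.*-monoʳ-≤-nonNeg a {{ℤ.nonNegative 0≤a}} 1≤f)

-1-mono-≤ : ∀ {a b} → a ≤ b → a ℤ.- + 1 ≤ b ℤ.- + 1
-1-mono-≤ = ℤP.+-monoˡ-≤ (- + 1)

-[a]*b≤a*b : ∀ a b → + 0 ≤ a * b → - a * b ≤ a * b
-[a]*b≤a*b a b 0≤ab = subst (_≤ a * b) (ℤP.neg-distribˡ-* a b) (ℤP.≤-trans (ℤP.neg-mono-≤ 0≤ab) 0≤ab)

toℚᵘ-toℚ : ∀ k → ℚ.toℚᵘ (toℚ k) ℚᵘ.≃ mkℚᵘ k 0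
toℚᵘ-toℚ k = ℚP.toℚᵘ-fromℚᵘ (mkℚᵘ k 0)

toℚ-+ : ∀ a b → toℚ (a + b) ≡ toℚ a ℚ.+ toℚ b
toℚ-+ a b = ℚP.toℚᵘ-injective (begin
  ℚ.toℚᵘ (toℚ (a + b))                     ≈⟨ toℚᵘ-toℚ (a + b) ⟩
  mkℚᵘ (a + b) 0                           ≈⟨ *≡* (entry a b) ⟩
  mkℚᵘ a 0 ℚᵘ.+ mkℚᵘ b 0                    ≈⟨ ℚᵘP.+-cong (toℚᵘ-toℚ a) (toℚᵘ-toℚ b) ⟨
  ℚ.toℚᵘ (toℚ a) ℚᵘ.+ ℚ.toℚᵘ (toℚ b)        ≈⟨ ℚP.toℚᵘ-homo-+ (toℚ a) (toℚ b) ⟨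
  ℚ.toℚᵘ (toℚ a ℚ.+ toℚ b)                 ∎)
  where
    open ℚᵘP.≃-Reasoning
    entry : ∀ a b → (a + b) * + 1 ≡ (a * + 1 + b * + 1) * + 1
    entry = solve-∀

toℚ-* : ∀ a b → toℚ (a * b) ≡ toℚ a ℚ.* toℚ b
toℚ-* a b = ℚP.toℚᵘ-injective (begin
  ℚ.toℚᵘ (toℚ (a * b))                     ≈⟨ toℚᵘ-toℚ (a * b) ⟩
  mkℚᵘ (a * b) 0                           ≈⟨ ℚᵘP.*-cong (toℚᵘ-toℚ a) (toℚᵘ-toℚ b) ⟨
  ℚ.toℚᵘ (toℚ a) ℚᵘ.* ℚ.toℚᵘ (toℚ b)        ≈⟨ ℚP.toℚᵘ-homo-* (toℚ a) (toℚ b) ⟨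
  ℚ.toℚᵘ (toℚ a ℚ.* toℚ b)                 ∎)
  where open ℚᵘP.≃-Reasoning

toℚ-neg : ∀ a → toℚ (- a) ≡ ℚ.- toℚ a
toℚ-neg a = ℚP.toℚᵘ-injective (begin
  ℚ.toℚᵘ (toℚ (- a))       ≈⟨ toℚᵘ-toℚ (- a) ⟩
  mkℚᵘ (- a) 0             ≈⟨ ℚᵘP.-‿cong (toℚᵘ-toℚ a) ⟨
  ℚᵘ.- ℚ.toℚᵘ (toℚ a)      ≈⟨ ℚP.toℚᵘ-homo‿- (toℚ a) ⟨
  ℚ.toℚᵘ (ℚ.- toℚ a)       ∎)
  where open ℚᵘP.≃-Reasoning

toℚ-injective : ∀ {a b} → toℚ a ≡ toℚ b → a ≡ b
toℚ-injective {a} {b} eq with ℚᵘP.≃-trans (ℚᵘP.≃-sym (toℚᵘ-toℚ a))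
                                (ℚᵘP.≃-trans (ℚᵘP.≃-reflexive (cong ℚ.toℚᵘ eq)) (toℚᵘ-toℚ b))
... | *≡* a*1≡b*1 = trans (sym (ℤP.*-identityʳ a)) (trans a*1≡b*1 (ℤP.*-identityʳ b))

toℚ-mono-≤ : ∀ {a b} → a ≤ b → toℚ a ℚ.≤ toℚ b
toℚ-mono-≤ {a} {b} a≤b = ℚP.toℚᵘ-cancel-≤
  (ℚᵘP.≤-respˡ-≃ (ℚᵘP.≃-sym (toℚᵘ-toℚ a)) (ℚᵘP.≤-respʳ-≃ (ℚᵘP.≃-sym (toℚᵘ-toℚ b))
    (*≤* (ℤP.*-monoʳ-≤-nonNeg (+ 1) a≤b))))

toℚ-mono-< : ∀ {a b} → a < b → toℚ a ℚ.< toℚ b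
toℚ-mono-< {a} {b} a<b = ℚP.toℚᵘ-cancel-<
  (ℚᵘP.<-respˡ-≃ (ℚᵘP.≃-sym (toℚᵘ-toℚ a)) (ℚᵘP.<-respʳ-≃ (ℚᵘP.≃-sym (toℚᵘ-toℚ b))
    (*<* (ℤP.*-monoʳ-<-pos (+ 1) a<b))))

toℚ-≢0 : ∀ {b} → b ≢ + 0 → toℚ b ≢ 0ℚ
toℚ-≢0 b≢0 eq = b≢0 (toℚ-injective eq)

recip-inverseʳ : ∀ q → q ≢ 0ℚ → q ℚ.* recip q ≡ 1ℚ
recip-inverseʳ q q≢0 with q ℚP.≟ 0ℚ
... | yes q≡0 = contradiction q≡0 q≢0
... | no q≢0′ = ℚP.*-inverseʳ q {{ℚ.≢-nonZero q≢0′}}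

*-cancelʳ : ∀ {p q} r → r ≢ 0ℚ → p ℚ.* r ≡ q ℚ.* r → p ≡ q
*-cancelʳ {p} {q} r r≢0 eq = begin
  p                        ≡⟨ ℚP.*-identityʳ p ⟨
  p ℚ.* 1ℚ                 ≡⟨ cong (p ℚ.*_) (recip-inverseʳ r r≢0) ⟨
  p ℚ.* (r ℚ.* recip r)    ≡⟨ ℚP.*-assoc p r (recip r) ⟨
  (p ℚ.* r) ℚ.* recip r    ≡⟨ cong (ℚ._* recip r) eq ⟩
  (q ℚ.* r) ℚ.* recip r    ≡⟨ ℚP.*-assoc q r (recip r) ⟩
  q ℚ.* (r ℚ.* recip r)    ≡⟨ cong (q ℚ.*_) (recip-inverseʳ r r≢0) ⟩
  q ℚ.* 1ℚ                 ≡⟨ ℚP.*-identityʳ q ⟩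
  q                        ∎
  where open ≡-Reasoning

recip-unique : ∀ q s → q ℚ.* s ≡ 1ℚ → recip q ≡ s
recip-unique q s qs≡1 = *-cancelʳ q q≢0
  (trans (ℚP.*-comm (recip q) q) (trans (recip-inverseʳ q q≢0) (trans (sym qs≡1) (ℚP.*-comm q s))))
  where
    q≢0 : q ≢ 0ℚ
    q≢0 refl = ℚP.1≢0 (trans (sym qs≡1) (ℚP.*-zeroˡ s))

-- a/b, with the junk value a/0 = 0 of recip
frac : ℤ → ℤ → ℚ
frac a b = toℚ a ℚ.* recip (toℚ b)

recip-toℚ : ∀ b → recip (toℚ b) ≡ frac (+ 1) b
recip-toℚ b = sym (ℚP.*-identityˡ (recip (toℚ b)))

frac-*-den : ∀ a {b} → b ≢ + 0 → frac a b ℚ.* toℚ b ≡ toℚ a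
frac-*-den a {b} b≢0 = begin
  (toℚ a ℚ.* recip (toℚ b)) ℚ.* toℚ b  ≡⟨ ℚP.*-assoc (toℚ a) _ _ ⟩
  toℚ a ℚ.* (recip (toℚ b) ℚ.* toℚ b)  ≡⟨ cong (toℚ a ℚ.*_) (ℚP.*-comm (recip (toℚ b)) (toℚ b)) ⟩
  toℚ a ℚ.* (toℚ b ℚ.* recip (toℚ b))  ≡⟨ cong (toℚ a ℚ.*_) (recip-inverseʳ (toℚ b) (toℚ-≢0 b≢0)) ⟩
  toℚ a ℚ.* 1ℚ                        ≡⟨ ℚP.*-identityʳ (toℚ a) ⟩
  toℚ a                               ∎
  where open ≡-Reasoning

frac-unique : ∀ {r} a {b} → b ≢ + 0 → r ℚ.* toℚ b ≡ toℚ a → r ≡ frac a b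
frac-unique a b≢0 eq = *-cancelʳ _ (toℚ-≢0 b≢0) (trans eq (sym (frac-*-den a b≢0)))

frac-one : ∀ a → frac a (+ 1) ≡ toℚ a
frac-one a = sym (frac-unique a {+ 1} (λ ()) (ℚP.*-identityʳ (toℚ a)))

frac-*-den-* : ∀ a {b d} → b ≢ + 0 → d ≢ + 0 → frac a b ℚ.* toℚ (b * d) ≡ toℚ (a * d)
frac-*-den-* a {b} {d} b≢0 d≢0 = begin
  frac a b ℚ.* toℚ (b * d)            ≡⟨ cong (frac a b ℚ.*_) (toℚ-* b d) ⟩
  frac a b ℚ.* (toℚ b ℚ.* toℚ d)      ≡⟨ ℚP.*-assoc (frac a b) _ _ ⟨
  (frac a b ℚ.* toℚ b) ℚ.* toℚ d      ≡⟨ cong (ℚ._* toℚ d) (frac-*-den a b≢0) ⟩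
  toℚ a ℚ.* toℚ d                     ≡⟨ toℚ-* a d ⟨
  toℚ (a * d)                         ∎
  where open ≡-Reasoning

frac-*-*-den : ∀ c {b d} → b ≢ + 0 → d ≢ + 0 → frac c d ℚ.* toℚ (b * d) ≡ toℚ (c * b)
frac-*-*-den c {b} {d} b≢0 d≢0 =
  trans (cong (λ t → frac c d ℚ.* toℚ t) (ℤP.*-comm b d)) (frac-*-den-* c d≢0 b≢0)

frac-cross : ∀ a {b} c {d} → b ≢ + 0 → d ≢ + 0 → a * d ≡ c * b → frac a b ≡ frac c d
frac-cross a {b} c {d} b≢0 d≢0 ad≡cb = *-cancelʳ (toℚ (b * d)) (toℚ-≢0 (*-≢0 b≢0 d≢0)) (begin
  frac a b ℚ.* toℚ (b * d)  ≡⟨ frac-*-den-* a b≢0 d≢0 ⟩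
  toℚ (a * d)               ≡⟨ cong toℚ ad≡cb ⟩
  toℚ (c * b)               ≡⟨ frac-*-*-den c b≢0 d≢0 ⟨
  frac c d ℚ.* toℚ (b * d)  ∎)
  where open ≡-Reasoning

frac-+ : ∀ a {b} c {d} → b ≢ + 0 → d ≢ + 0 → frac a b ℚ.+ frac c d ≡ frac (a * d + c * b) (b * d)
frac-+ a {b} c {d} b≢0 d≢0 = frac-unique (a * d + c * b) (*-≢0 b≢0 d≢0) (begin
  (frac a b ℚ.+ frac c d) ℚ.* toℚ (b * d)                ≡⟨ ℚP.*-distribʳ-+ (toℚ (b * d)) (frac a b) (frac c d) ⟩
  frac a b ℚ.* toℚ (b * d) ℚ.+ frac c d ℚ.* toℚ (b * d)  ≡⟨ cong₂ ℚ._+_ (frac-*-den-* a b≢0 d≢0) (frac-*-*-den c b≢0 d≢0) ⟩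
  toℚ (a * d) ℚ.+ toℚ (c * b)                            ≡⟨ toℚ-+ (a * d) (c * b) ⟨
  toℚ (a * d + c * b)                                    ∎)
  where open ≡-Reasoning

frac-neg : ∀ a {b} → b ≢ + 0 → ℚ.- frac a b ≡ frac (- a) b
frac-neg a {b} b≢0 = frac-unique (- a) b≢0 (begin
  ℚ.- frac a b ℚ.* toℚ b     ≡⟨ ℚP.neg-distribˡ-* (frac a b) (toℚ b) ⟨
  ℚ.- (frac a b ℚ.* toℚ b)   ≡⟨ cong ℚ.-_ (frac-*-den a b≢0) ⟩
  ℚ.- toℚ a                  ≡⟨ toℚ-neg a ⟨
  toℚ (- a)                  ∎)
  where open ≡-Reasoning

toℚ-+-frac : ∀ c a {b} → b ≢ + 0 → toℚ c ℚ.+ frac a b ≡ frac (c * b + a) b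
toℚ-+-frac c a {b} b≢0 = begin
  toℚ c ℚ.+ frac a b              ≡⟨ cong (ℚ._+ frac a b) (frac-one c) ⟨
  frac c (+ 1) ℚ.+ frac a b       ≡⟨ frac-+ c {+ 1} a (λ ()) b≢0 ⟩
  frac (c * b + a * + 1) (+ 1 * b) ≡⟨ frac-cross (c * b + a * + 1) (c * b + a) (*-≢0 {+ 1} (λ ()) b≢0) b≢0 (entry c a b) ⟩
  frac (c * b + a) b              ∎
  where
    open ≡-Reasoning
    entry : ∀ c a b → (c * b + a * + 1) * b ≡ (c * b + a) * (+ 1 * b)
    entry = solve-∀

recip-frac : ∀ {a b} → a ≢ + 0 → b ≢ + 0 → recip (frac a b) ≡ frac b a
recip-frac {a} {b} a≢0 b≢0 = recip-unique (frac a b) (frac b a) (begin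
  (p ℚ.* recip q) ℚ.* (q ℚ.* recip p)    ≡⟨ regroup p q (recip p) (recip q) ⟩
  (p ℚ.* recip p) ℚ.* (q ℚ.* recip q)    ≡⟨ cong₂ ℚ._*_ (recip-inverseʳ p (toℚ-≢0 a≢0)) (recip-inverseʳ q (toℚ-≢0 b≢0)) ⟩
  1ℚ ℚ.* 1ℚ                              ≡⟨⟩
  1ℚ                                     ∎)
  where
    open ≡-Reasoning
    open ℚ-Solver.+-*-Solver
    p = toℚ a
    q = toℚ b
    regroup : ∀ p q p′ q′ → (p ℚ.* q′) ℚ.* (q ℚ.* p′) ≡ (p ℚ.* p′) ℚ.* (q ℚ.* q′)
    regroup = solve 4 (λ p q p′ q′ → (p :* q′) :* (q :* p′) := (p :* p′) :* (q :* q′)) refl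

frac-≤ : ∀ a {b} c {d} → + 0 < b → + 0 < d → a * d ≤ c * b → frac a b ℚ.≤ frac c d
frac-≤ a {b} c {d} 0<b 0<d ad≤cb =
  ℚP.*-cancelʳ-≤-pos (toℚ (b * d)) {{ℚ.positive (toℚ-mono-< (*-pos 0<b 0<d))}}
    (subst₂ ℚ._≤_ (sym (frac-*-den-* a (pos⇒≢0 0<b) (pos⇒≢0 0<d))) (sym (frac-*-*-den c (pos⇒≢0 0<b) (pos⇒≢0 0<d)))
      (toℚ-mono-≤ ad≤cb))

frac-< : ∀ a {b} c {d} → + 0 < b → + 0 < d → a * d < c * b → frac a b ℚ.< frac c d
frac-< a {b} c {d} 0<b 0<d ad<cb =
  ℚP.*-cancelʳ-<-nonNeg (toℚ (b * d)) {{ℚ.nonNegative (ℚP.<⇒≤ (toℚ-mono-< (*-pos 0<b 0<d)))}}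
    (subst₂ ℚ._<_ (sym (frac-*-den-* a (pos⇒≢0 0<b) (pos⇒≢0 0<d))) (sym (frac-*-*-den c (pos⇒≢0 0<b) (pos⇒≢0 0<d)))
      (toℚ-mono-< ad<cb))

∣frac∣-≤ : ∀ a {b} c {d} → + 0 < b → + 0 < d → a * d ≤ c * b → - a * d ≤ c * b →
  ℚ.∣ frac a b ∣ ℚ.≤ frac c d
∣frac∣-≤ a {b} c {d} 0<b 0<d ad≤cb -ad≤cb with ℚP.∣p∣≡p∨∣p∣≡-p (frac a b)
... | inj₁ ∣q∣≡q  = subst (ℚ._≤ frac c d) (sym ∣q∣≡q) (frac-≤ a c 0<b 0<d ad≤cb)
... | inj₂ ∣q∣≡-q = subst (ℚ._≤ frac c d) (sym (trans ∣q∣≡-q (frac-neg a (pos⇒≢0 0<b))))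
                      (frac-≤ (- a) c 0<b 0<d -ad≤cb)

∣frac-±∣-≤ : ∀ {x y b} c {d} → x ≡ y ⊎ x ≡ - y → + 0 < b → + 0 < d → + 0 ≤ y * d → y * d ≤ c * b →
  ℚ.∣ frac x b ∣ ℚ.≤ frac c d
∣frac-±∣-≤ {y = y} c {d} (inj₁ refl) 0<b 0<d 0≤yd yd≤cb =
  ∣frac∣-≤ y c 0<b 0<d yd≤cb (ℤP.≤-trans (-[a]*b≤a*b y d 0≤yd) yd≤cb)
∣frac-±∣-≤ {y = y} c {d} (inj₂ refl) 0<b 0<d 0≤yd yd≤cb =
  ∣frac∣-≤ (- y) c 0<b 0<d (ℤP.≤-trans (-[a]*b≤a*b y d 0≤yd) yd≤cb)
    (subst (λ v → v * d ≤ c * _) (sym (ℤP.neg-involutive y)) yd≤cb)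

frac-step : ∀ X p q → q ≢ + 0 → X * q * q ≢ + 0 →
  frac (X * p * q + + 1) (X * q * q) ≡ frac p q ℚ.+ frac (+ 1) (X * q * q)
frac-step X p q q≢0 Xqq≢0 = sym (trans (frac-+ p (+ 1) q≢0 Xqq≢0)
  (frac-cross (p * (X * q * q) + + 1 * q) (X * p * q + + 1) (*-≢0 q≢0 Xqq≢0) Xqq≢0 (cross X p q)))
  where
    cross : ∀ X p q → (p * (X * q * q) + + 1 * q) * (X * q * q) ≡ (X * p * q + + 1) * (q * (X * q * q))
    cross = solve-∀

∣-∣-triangle : ∀ p q r → ℚ.∣ p ℚ.- q ∣ ℚ.≤ ℚ.∣ p ℚ.- r ∣ ℚ.+ ℚ.∣ q ℚ.- r ∣
∣-∣-triangle p q r =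
  subst (λ d → ℚ.∣ d ∣ ℚ.≤ ℚ.∣ p ℚ.- r ∣ ℚ.+ ℚ.∣ q ℚ.- r ∣) (sym (via r))
    (ℚP.∣p-q∣≤∣p∣+∣q∣ (p ℚ.- r) (q ℚ.- r))
  where
    open ℚ-Solver.+-*-Solver
    via : ∀ r → p ℚ.- q ≡ (p ℚ.- r) ℚ.- (q ℚ.- r)
    via = solve 3 (λ p q r → p :- q := (p :- r) :- (q :- r)) refl p q

↥-pos : ∀ ε → 0ℚ ℚ.< ε → + 1 ≤ ℚ.↥ ε
↥-pos (ℚ.mkℚ (+ suc n) _ _) _ = ℤ.+≤+ (s≤s z≤n)
↥-pos (ℚ.mkℚ (+ zero) _ _) (ℚ.*<* (ℤ.+<+ ()))
↥-pos (ℚ.mkℚ ℤ.-[1+ n ] _ _) (ℚ.*<* ())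

ε-as-frac : ∀ ε → ε ≡ frac (ℚ.↥ ε) (+ ℚ.↧ₙ ε)
ε-as-frac ε@(ℚ.mkℚ n d _) = trans (sym (ℚP.↥p/↧p≡p ε)) (frac-unique n {+ suc d} (λ ()) (ℚP.toℚᵘ-injective (begin
  ℚ.toℚᵘ (n ℚ./ suc d ℚ.* toℚ (+ suc d))             ≈⟨ ℚP.toℚᵘ-homo-* (n ℚ./ suc d) (toℚ (+ suc d)) ⟩
  ℚ.toℚᵘ (n ℚ./ suc d) ℚᵘ.* ℚ.toℚᵘ (toℚ (+ suc d))    ≈⟨ ℚᵘP.*-cong (ℚP.toℚᵘ-fromℚᵘ (mkℚᵘ n d)) (toℚᵘ-toℚ (+ suc d)) ⟩
  mkℚᵘ n d ℚᵘ.* mkℚᵘ (+ suc d) 0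
    ≈⟨ *≡* (trans (ℤP.*-identityʳ (n * + suc d)) (cong (λ m → n * + suc m) (sym (ℕP.*-identityʳ d)))) ⟩
  mkℚᵘ n 0                                            ≈⟨ toℚᵘ-toℚ n ⟨
  ℚ.toℚᵘ (toℚ n)                                      ∎)))
  where open ℚᵘP.≃-Reasoning

two-fracs-< : ∀ ε → 0ℚ ℚ.< ε → ∀ Q → + 2 * + ℚ.↧ₙ ε < Q → frac (+ 1) Q ℚ.+ frac (+ 1) Q ℚ.< ε
two-fracs-< ε 0<ε Q 2D<Q = subst₂ ℚ._<_ (sym (frac-+ (+ 1) (+ 1) Q≢0 Q≢0)) (sym (ε-as-frac ε))
  (frac-< (+ 1 * Q + + 1 * Q) (ℚ.↥ ε) (*-pos 0<Q 0<Q) (ℤ.+<+ (s≤s z≤n)) (begin-strict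
    (+ 1 * Q + + 1 * Q) * D   ≡⟨ left Q D ⟩
    Q * (+ 2 * D)             <⟨ ℤP.*-monoˡ-<-pos Q {{ℤ.positive 0<Q}} 2D<Qn ⟩
    Q * (Q * n)               ≡⟨ right Q n ⟩
    n * (Q * Q)               ∎))
  where
    open ℤP.≤-Reasoning
    n = ℚ.↥ ε
    D = + ℚ.↧ₙ ε
    0<Q = ℤP.<-trans (*-pos {+ 2} {D} (ℤ.+<+ (s≤s z≤n)) (ℤ.+<+ (s≤s z≤n))) 2D<Q
    Q≢0 = pos⇒≢0 0<Q
    2D<Qn : + 2 * D < Q * n
    2D<Qn = ℤP.<-≤-trans 2D<Q (subst (_≤ Q * n) (ℤP.*-identityʳ Q)
      (ℤP.*-monoˡ-≤-nonNeg Q {{ℤ.nonNegative (ℤP.<⇒≤ 0<Q)}} (↥-pos ε 0<ε)))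
    left : ∀ Q D → (+ 1 * Q + + 1 * Q) * D ≡ Q * (+ 2 * D)
    left = solve-∀
    right : ∀ Q n → Q * (Q * n) ≡ n * (Q * Q)
    right = solve-∀

-- Continued fractions with positive partial quotients

PositiveBelow : ℕ → (ℕ → ℤ) → Set
PositiveBelow n f = ∀ i → i ℕ.< n → + 1 ≤ f i

positiveBelow-tail : ∀ {n f} → PositiveBelow (suc n) f → PositiveBelow n (f ∘ suc)
positiveBelow-tail pos i i<n = pos (suc i) (s≤s i<n)

record Admissible (A : Mat ℤ) : Set where
  field
    m11-pos    : + 1 ≤ m11 A
    m12-nonneg : + 0 ≤ m12 A
    m21-nonneg : + 0 ≤ m21 A
    m22-nonneg : + 0 ≤ m22 A
    m21≤m11    : m21 A ≤ m11 A
open Admissible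

unit-row : ∀ a c → + 1 * a + + 0 * c ≡ a
unit-row = solve-∀

admissible-M⊗ : ∀ {f A} → + 1 ≤ f → Admissible A → Admissible (M f ⊗ A)
admissible-M⊗ {f} {mat a b c d} 1≤f adm = record
  { m11-pos    = ℤP.≤-trans (m11-pos adm) a≤m11
  ; m12-nonneg = ℤP.+-mono-≤ (nonNeg-* 0≤f (m12-nonneg adm)) (nonNeg-* {+ 1} (ℤ.+≤+ z≤n) (m22-nonneg adm))
  ; m21-nonneg = subst (+ 0 ≤_) (sym (unit-row a c)) 0≤a
  ; m22-nonneg = subst (+ 0 ≤_) (sym (unit-row b d)) (m12-nonneg adm)
  ; m21≤m11    = subst (_≤ f * a + + 1 * c) (sym (unit-row a c)) a≤m11
  }
  where
    0≤a = ℤP.≤-trans (ℤ.+≤+ z≤n) (m11-pos adm)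
    0≤f = ℤP.≤-trans (ℤ.+≤+ z≤n) 1≤f
    a≤m11 : a ≤ f * a + + 1 * c
    a≤m11 = ℤP.≤-trans (≤-*ˡ 1≤f 0≤a) (≤-+-nonNeg (nonNeg-* {+ 1} (ℤ.+≤+ z≤n) (m21-nonneg adm)))

admissible-cfMatrix : ∀ n f → PositiveBelow n f → Admissible (cfMatrix f n)
admissible-cfMatrix zero f pos = record
  { m11-pos = ℤP.≤-refl ; m12-nonneg = ℤP.≤-refl ; m21-nonneg = ℤP.≤-refl
  ; m22-nonneg = ℤ.+≤+ z≤n ; m21≤m11 = ℤ.+≤+ z≤n }
admissible-cfMatrix (suc n) f pos =
  admissible-M⊗ (pos 0 (s≤s z≤n)) (admissible-cfMatrix n (f ∘ suc) (positiveBelow-tail pos))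

m21-cfMatrix-pos : ∀ ℓ f → 1 ℕ.≤ ℓ → PositiveBelow ℓ f → + 1 ≤ m21 (cfMatrix f ℓ)
m21-cfMatrix-pos (suc n) f _ pos = subst (+ 1 ≤_) (sym (unit-row (m11 P) (m21 P)))
  (m11-pos (admissible-cfMatrix n (f ∘ suc) (positiveBelow-tail pos)))
  where P = cfMatrix (f ∘ suc) n

applyUpTo-cong : ∀ n {f g : ℕ → ℤ} → (∀ i → i ℕ.< n → f i ≡ g i) → applyUpTo f n ≡ applyUpTo g n
applyUpTo-cong zero f≗g = refl
applyUpTo-cong (suc n) f≗g =
  cong₂ _∷_ (f≗g 0 (s≤s z≤n)) (applyUpTo-cong n (λ i i<n → f≗g (suc i) (s≤s i<n)))

cfEval-cfMatrix : ∀ ℓ f → 1 ℕ.≤ ℓ → PositiveBelow ℓ f →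
  cfEval (applyUpTo f ℓ) ≡ frac (m11 (cfMatrix f ℓ)) (m21 (cfMatrix f ℓ))
cfEval-cfMatrix 1 f _ pos =
  trans (sym (frac-one (f 0))) (cong (λ B → frac (m11 B) (m21 B)) (sym (⊗-identityʳ (M (f 0)))))
cfEval-cfMatrix (suc (suc n)) f _ pos = begin
  toℚ (f 0) ℚ.+ recip (cfEval (applyUpTo (f ∘ suc) (suc n)))
    ≡⟨ cong (λ v → toℚ (f 0) ℚ.+ recip v) (cfEval-cfMatrix (suc n) (f ∘ suc) (s≤s z≤n) (positiveBelow-tail pos)) ⟩
  toℚ (f 0) ℚ.+ recip (frac a c)     ≡⟨ cong (toℚ (f 0) ℚ.+_) (recip-frac a≢0 c≢0) ⟩
  toℚ (f 0) ℚ.+ frac c a             ≡⟨ toℚ-+-frac (f 0) c a≢0 ⟩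
  frac (f 0 * a + c) a               ≡⟨ cong₂ frac (cong (_+_ (f 0 * a)) (sym (ℤP.*-identityˡ c))) (sym (unit-row a c)) ⟩
  frac (f 0 * a + + 1 * c) (+ 1 * a + + 0 * c) ∎
  where
    open ≡-Reasoning
    P = cfMatrix (f ∘ suc) (suc n)
    a = m11 P
    c = m21 P
    a≢0 = pos⇒≢0 (1≤⇒pos (m11-pos (admissible-cfMatrix (suc n) (f ∘ suc) (positiveBelow-tail pos))))
    c≢0 = pos⇒≢0 (1≤⇒pos (m21-cfMatrix-pos (suc n) (f ∘ suc) (s≤s z≤n) (positiveBelow-tail pos)))

-- The difference is ∓s/((q t + q′ s) q) as the determinant is ±1, and s q ≤ q t + q′ s.
frac-extension-gap : ∀ p p′ q q′ t s → + 1 ≤ q → + 0 ≤ q′ → + 0 ≤ s → s ≤ t → + 1 ≤ q * t + q′ * s →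
  p * q′ + - (p′ * q) ≡ + 1 ⊎ p * q′ + - (p′ * q) ≡ - + 1 →
  ℚ.∣ frac (p * t + p′ * s) (q * t + q′ * s) ℚ.- frac p q ∣ ℚ.≤ frac (+ 1) (q * q)
frac-extension-gap p p′ q q′ t s 1≤q 0≤q′ 0≤s s≤t 1≤den det± =
  subst (λ v → ℚ.∣ v ∣ ℚ.≤ frac (+ 1) (q * q)) (sym difference)
    (∣frac-±∣-≤ (+ 1) (numerator-± det±) (*-pos 0<den 0<q) (*-pos 0<q 0<q) (nonNeg-* 0≤s (nonNeg-* 0≤q 0≤q)) sq²≤den·q)
  where
    num = p * t + p′ * s
    den = q * t + q′ * s
    0<q = 1≤⇒pos 1≤q
    0≤q = ℤP.<⇒≤ 0<q
    0<den = 1≤⇒pos 1≤den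
    difference : frac num den ℚ.- frac p q ≡ frac (num * q + - p * den) (den * q)
    difference = trans (cong (frac num den ℚ.+_) (frac-neg p (pos⇒≢0 0<q)))
                       (frac-+ num (- p) (pos⇒≢0 0<den) (pos⇒≢0 0<q))
    numerator : ∀ p p′ q q′ t s →
      (p * t + p′ * s) * q + - p * (q * t + q′ * s) ≡ - ((p * q′ + - (p′ * q)) * s)
    numerator = solve-∀
    numerator-± : p * q′ + - (p′ * q) ≡ + 1 ⊎ p * q′ + - (p′ * q) ≡ - + 1 →
      num * q + - p * den ≡ s ⊎ num * q + - p * den ≡ - s
    numerator-± (inj₁ det≡1) =
      inj₂ (trans (numerator p p′ q q′ t s) (trans (cong (λ D → - (D * s)) det≡1) (cong -_ (ℤP.*-identityˡ s))))
    numerator-± (inj₂ det≡-1) =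
      inj₁ (trans (numerator p p′ q q′ t s) (trans (cong (λ D → - (D * s)) det≡-1)
        (trans (cong -_ (ℤP.-1*i≡-i s)) (ℤP.neg-involutive s))))
    sq≤den : s * q ≤ den
    sq≤den = ℤP.≤-trans (subst (s * q ≤_) (ℤP.*-comm t q) (ℤP.*-monoʳ-≤-nonNeg q {{ℤ.nonNegative 0≤q}} s≤t))
                        (≤-+-nonNeg (nonNeg-* 0≤q′ 0≤s))
    sq²≤den·q : s * (q * q) ≤ + 1 * (den * q)
    sq²≤den·q = subst₂ _≤_ (ℤP.*-assoc s q q) (sym (ℤP.*-identityˡ (den * q)))
                  (ℤP.*-monoʳ-≤-nonNeg q {{ℤ.nonNegative 0≤q}} sq≤den)

cfEval-gap : ∀ ℓ m f → 1 ℕ.≤ ℓ → ℓ ℕ.≤ m → PositiveBelow m f →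
  ℚ.∣ cfEval (applyUpTo f m) ℚ.- cfEval (applyUpTo f ℓ) ∣ ℚ.≤ frac (+ 1) (m21 (cfMatrix f ℓ) * m21 (cfMatrix f ℓ))
cfEval-gap ℓ m f 1≤ℓ ℓ≤m =
  subst (λ m → PositiveBelow m f → ℚ.∣ cfEval (applyUpTo f m) ℚ.- cfEval (applyUpTo f ℓ) ∣ ℚ.≤ frac (+ 1) (q * q))
    (ℕP.m+[n∸m]≡n ℓ≤m) (gap (m ℕ.∸ ℓ))
  where
    P = cfMatrix f ℓ
    q = m21 P
    gap : ∀ s → PositiveBelow (ℓ ℕ.+ s) f →
      ℚ.∣ cfEval (applyUpTo f (ℓ ℕ.+ s)) ℚ.- cfEval (applyUpTo f ℓ) ∣ ℚ.≤ frac (+ 1) (q * q)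
    gap s pos = subst₂ (λ u v → ℚ.∣ u ℚ.- v ∣ ℚ.≤ frac (+ 1) (q * q))
      (sym (trans (cfEval-cfMatrix (ℓ ℕ.+ s) f (ℕP.≤-trans 1≤ℓ (ℕP.m≤m+n ℓ s)) pos)
                  (cong (λ B → frac (m11 B) (m21 B)) (cfMatrix-++ ℓ s f))))
      (sym (cfEval-cfMatrix ℓ f 1≤ℓ posP))
      (frac-extension-gap (m11 P) (m12 P) q (m22 P) (m11 Tail) (m21 Tail)
        (m21-cfMatrix-pos ℓ f 1≤ℓ posP) (m22-nonneg admP) (m21-nonneg admT) (m21≤m11 admT)
        (subst (λ B → + 1 ≤ m21 B) (cfMatrix-++ ℓ s f)
          (m21-cfMatrix-pos (ℓ ℕ.+ s) f (ℕP.≤-trans 1≤ℓ (ℕP.m≤m+n ℓ s)) pos))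
        (det-cfMatrix ℓ f))
      where
        Tail = cfMatrix (λ i → f (ℓ ℕ.+ i)) s
        posP : PositiveBelow ℓ f
        posP i i<ℓ = pos i (ℕP.≤-trans i<ℓ (ℕP.m≤m+n ℓ s))
        admP = admissible-cfMatrix ℓ f posP
        admT = admissible-cfMatrix s _ (λ i i<s → pos (ℓ ℕ.+ i) (ℕP.+-monoʳ-< ℓ i<s))

-- The folding lemma

unfolded-m11 : ∀ W l x → m11 (unfolded W l x) ≡ x * m11 (folded W l) * m21 (folded W l) + - det (folded W l)
unfolded-m11 (mat a b c d) l x = solve 6 (λ a b c d l x →
    let F = Symbolic.folded (mat a b c d) l
    in m11 (Symbolic.unfolded (mat a b c d) l x) := x :* m11 F :* m21 F :- Symbolic.det F)
  refl a b c d l x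
  where open ℤ-Solver.+-*-Solver

unfolded-m21 : ∀ W l x → m21 (unfolded W l x) ≡ x * m21 (folded W l) * m21 (folded W l)
unfolded-m21 (mat a b c d) l x = solve 6 (λ a b c d l x →
    let F = Symbolic.folded (mat a b c d) l
    in m21 (Symbolic.unfolded (mat a b c d) l x) := x :* m21 F :* m21 F)
  refl a b c d l x
  where open ℤ-Solver.+-*-Solver

unfolded-det : ∀ W l x → det (unfolded W l x) ≡ - (det (folded W l) * det (folded W l))
unfolded-det (mat a b c d) l x = solve 6 (λ a b c d l x →
    let F = Symbolic.folded (mat a b c d) l
    in Symbolic.det (Symbolic.unfolded (mat a b c d) l x) := :- (Symbolic.det F :* Symbolic.det F))
  refl a b c d l x
  where open ℤ-Solver.+-*-Solver

cfMatrix-fold : ∀ (g : ℕ → ℤ) ℓ → 3 ℕ.≤ ℓ → g 0 ≡ + 1 →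
  cfMatrix g ℓ ≡ folded (cfMatrix (g ∘ suc) (ℓ ℕ.∸ 2)) (g (ℓ ℕ.∸ 1))
cfMatrix-fold g .(suc (suc (suc r))) (s≤s (s≤s (s≤s {n = r} _))) g0≡1 =
  cong₂ _⊗_ (cong M g0≡1) (cfMatrix-snoc (suc r) (g ∘ suc))

cfMatrix-unfold : ∀ (g h : ℕ → ℤ) ℓ x → 3 ℕ.≤ ℓ → g 0 ≡ + 1 →
  (∀ j → j ℕ.< ℓ → h j ≡ g j) →
  h ℓ ≡ x ℤ.- + 1 →
  h (suc ℓ) ≡ + 1 →
  h (suc (suc ℓ)) ≡ g (ℓ ℕ.∸ 1) ℤ.- + 1 →
  (∀ i → 3 ℕ.≤ i → i ℕ.≤ ℓ → h (ℓ ℕ.+ i) ≡ g (suc ℓ ℕ.∸ i)) →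
  cfMatrix h (ℓ ℕ.+ suc ℓ) ≡ unfolded (cfMatrix (g ∘ suc) (ℓ ℕ.∸ 2)) (g (ℓ ℕ.∸ 1)) x
cfMatrix-unfold g h .(suc (suc (suc r))) x (s≤s (s≤s (s≤s {n = r} _))) g0≡1 below at-ℓ at-1+ℓ at-2+ℓ mirror = begin
  cfMatrix h (ℓ ℕ.+ suc ℓ)                            ≡⟨ cfMatrix-++ ℓ (suc ℓ) h ⟩
  cfMatrix h ℓ ⊗ cfMatrix (λ i → h (ℓ ℕ.+ i)) (suc ℓ)  ≡⟨ cong₂ _⊗_ old new ⟩
  unfolded W (g (suc (suc r))) x                      ∎
  where
    open ≡-Reasoning
    ℓ = suc (suc (suc r))
    W = cfMatrix (g ∘ suc) (suc r)
    old : cfMatrix h ℓ ≡ folded W (g (suc (suc r)))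
    old = trans (cfMatrix-cong ℓ below) (cfMatrix-fold g ℓ (s≤s (s≤s (s≤s z≤n))) g0≡1)
    reversed : cfMatrix (λ i → h (ℓ ℕ.+ suc (suc (suc i)))) (suc r) ≡ transpose W
    reversed = trans (cfMatrix-cong (suc r) (λ i i<r →
                       trans (mirror (3 ℕ.+ i) (s≤s (s≤s (s≤s z≤n))) (ℕP.+-monoʳ-≤ 3 (ℕP.≤-pred i<r)))
                             (cong g (ℕP.+-∸-assoc 1 (ℕP.≤-pred i<r)))))
                     (cfMatrix-reverse (suc r) (g ∘ suc))
    new : cfMatrix (λ i → h (ℓ ℕ.+ i)) (suc ℓ) ≡ M (x ℤ.- + 1) ⊗ M (+ 1) ⊗ M (g (suc (suc r)) ℤ.- + 1) ⊗ transpose W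
    new = cong₂ _⊗_ (cong M (trans (cong h (ℕP.+-identityʳ ℓ)) at-ℓ))
          (cong₂ _⊗_ (cong M (trans (cong h (ℕP.+-comm ℓ 1)) at-1+ℓ))
          (cong₂ _⊗_ (cong M (trans (cong h (ℕP.+-comm ℓ 2)) at-2+ℓ))
          reversed))

len : ℕ → ℕ
len k = ell (k ℕ.+ 3)

suc-len : ∀ k → suc (len k) ≡ 3 ℕ.* 2 ℕ.^ suc k
suc-len k = begin
  suc (len k)                       ≡⟨ cong (suc ∘ ell) (ℕP.+-comm k 3) ⟩
  suc (3 ℕ.* 2 ℕ.^ suc k ℕ.∸ 1)     ≡⟨ ℕP.+-comm 1 _ ⟩
  3 ℕ.* 2 ℕ.^ suc k ℕ.∸ 1 ℕ.+ 1     ≡⟨ ℕP.m∸n+n≡m (ℕP.*-mono-≤ {1} {3} (s≤s z≤n) (ℕP.m^n>0 2 (suc k))) ⟩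
  3 ℕ.* 2 ℕ.^ suc k                 ∎
  where open ≡-Reasoning

len-suc : ∀ k → len (suc k) ≡ len k ℕ.+ suc (len k)
len-suc k = ℕP.suc-injective (begin
  suc (len (suc k))                 ≡⟨ suc-len (suc k) ⟩
  3 ℕ.* (2 ℕ.* 2 ℕ.^ suc k)         ≡⟨ double (2 ℕ.^ suc k) ⟩
  3 ℕ.* 2 ℕ.^ suc k ℕ.+ 3 ℕ.* 2 ℕ.^ suc k  ≡⟨ cong₂ ℕ._+_ (suc-len k) (suc-len k) ⟨
  suc (len k) ℕ.+ suc (len k)       ∎)
  where
    open ≡-Reasoning
    double : ∀ y → 3 ℕ.* (2 ℕ.* y) ≡ 3 ℕ.* y ℕ.+ 3 ℕ.* y
    double = ℕ-Ring.solve-∀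

len-≥ : ∀ k → k ℕ.+ 3 ℕ.≤ len k
len-≥ zero = s≤s (s≤s (s≤s z≤n))
len-≥ (suc k) = subst (suc k ℕ.+ 3 ℕ.≤_) (sym (len-suc k)) (ℕP.≤-trans (s≤s (len-≥ k)) (ℕP.m≤n+m _ (len k)))

len-≤-+ : ∀ m k → len k ℕ.≤ len (m ℕ.+ k)
len-≤-+ zero k = ℕP.≤-refl
len-≤-+ (suc m) k = ℕP.≤-trans (len-≤-+ m k) (subst (len (m ℕ.+ k) ℕ.≤_) (sym (len-suc (m ℕ.+ k))) (ℕP.m≤m+n _ _))

if-T : ∀ {X : Set} {b} {x y : X} → T b → (if b then x else y) ≡ x
if-T {b = true} _ = refl

if-¬T : ∀ {X : Set} {b} {x y : X} → ¬ T b → (if b then x else y) ≡ y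
if-¬T {b = false} _ = refl
if-¬T {b = true} ¬t = contradiction _ ¬t

≥⇒¬<ᵇ : ∀ m n → n ℕ.≤ m → ¬ T (m <ᵇ n)
≥⇒¬<ᵇ m n n≤m m<ᵇn = ℕP.<⇒≱ (ℕP.<ᵇ⇒< m n m<ᵇn) n≤m

>⇒¬≡ᵇ : ∀ m n → n ℕ.< m → ¬ T (m ≡ᵇ n)
>⇒¬≡ᵇ m n n<m m≡ᵇn = ℕP.<⇒≢ n<m (sym (ℕP.≡ᵇ⇒≡ m n m≡ᵇn))

module _ (z : ℕ → ℤ) (k : ℕ) where
  private
    g = A z k
    h = A z (suc k)
    L = len k

  A-suc-below : ∀ j → j ℕ.< L → h j ≡ g j
  A-suc-below j j<L = if-T (ℕP.<⇒<ᵇ j<L)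

  A-suc-at-len : h L ≡ z (suc (k ℕ.+ 3)) ℤ.- + 1
  A-suc-at-len = trans (if-¬T (≥⇒¬<ᵇ L L ℕP.≤-refl)) (if-T (ℕP.≡⇒≡ᵇ L L refl))

  A-suc-at-1+len : h (suc L) ≡ + 1
  A-suc-at-1+len =
    trans (if-¬T (≥⇒¬<ᵇ (suc L) L (ℕP.n≤1+n L)))
    (trans (if-¬T (>⇒¬≡ᵇ (suc L) L ℕP.≤-refl))
    (if-T (ℕP.≡⇒≡ᵇ (suc L) (suc L) refl)))

  A-suc-at-2+len : h (suc (suc L)) ≡ g (L ℕ.∸ 1) ℤ.- + 1
  A-suc-at-2+len =
    trans (if-¬T (≥⇒¬<ᵇ (suc (suc L)) L (ℕP.m≤n+m L 2)))
    (trans (if-¬T (>⇒¬≡ᵇ (suc (suc L)) L (ℕP.m<n+m L {2} (s≤s z≤n))))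
    (trans (if-¬T (>⇒¬≡ᵇ (suc (suc L)) (suc L) ℕP.≤-refl))
    (if-T (ℕP.≡⇒≡ᵇ (suc (suc L)) (suc (suc L)) refl))))

  A-suc-mirror : ∀ i → 3 ℕ.≤ i → i ℕ.≤ L → h (L ℕ.+ i) ≡ g (suc L ℕ.∸ i)
  A-suc-mirror i 3≤i i≤L =
    trans (if-¬T (≥⇒¬<ᵇ (L ℕ.+ i) L (ℕP.m≤m+n L i)))
    (trans (if-¬T (>⇒¬≡ᵇ (L ℕ.+ i) L (above 0 (ℕP.≤-trans (s≤s z≤n) 3≤i))))
    (trans (if-¬T (>⇒¬≡ᵇ (L ℕ.+ i) (suc L) (above 1 (ℕP.≤-trans (s≤s (s≤s z≤n)) 3≤i))))
    (trans (if-¬T (>⇒¬≡ᵇ (L ℕ.+ i) (suc (suc L)) (above 2 3≤i)))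
    (trans (if-T (ℕP.≤⇒≤ᵇ (ℕP.+-monoʳ-≤ L (subst (i ℕ.≤_) (sym (ℕP.+-identityʳ L)) i≤L))))
    (cong g index)))))
    where
      above : ∀ t → t ℕ.< i → t ℕ.+ L ℕ.< L ℕ.+ i
      above t t<i = subst (ℕ._< L ℕ.+ i) (ℕP.+-comm L t) (ℕP.+-monoʳ-< L t<i)
      index : 2 ℕ.* L ℕ.+ 1 ℕ.∸ (L ℕ.+ i) ≡ suc L ℕ.∸ i
      index = trans (cong (ℕ._∸ (L ℕ.+ i)) (twice L)) (ℕP.[m+n]∸[m+o]≡n∸o L (suc L) i)
        where
          twice : ∀ L → 2 ℕ.* L ℕ.+ 1 ≡ L ℕ.+ suc L
          twice = ℕ-Ring.solve-∀

A-stable : ∀ z m k j → j ℕ.< len k → A z (m ℕ.+ k) j ≡ A z k j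
A-stable z zero k j j<len = refl
A-stable z (suc m) k j j<len =
  trans (A-suc-below z (m ℕ.+ k) j (ℕP.≤-trans j<len (len-≤-+ m k))) (A-stable z m k j j<len)

initial-m11 : ∀ a b → m11 (initial a b) ≡ b * (a + + 1) * a + + 1
initial-m11 = solve 2 (λ a b → m11 (Symbolic.initial a b) := b :* (a :+ con (+ 1)) :* a :+ con (+ 1)) refl
  where open ℤ-Solver.+-*-Solver

initial-m21 : ∀ a b → m21 (initial a b) ≡ b * a * a
initial-m21 = solve 2 (λ a b → m21 (Symbolic.initial a b) := b :* a :* a) refl
  where open ℤ-Solver.+-*-Solver

initial-det : ∀ a b → det (initial a b) ≡ - + 1
initial-det = solve 2 (λ a b → Symbolic.det (Symbolic.initial a b) := :- con (+ 1)) refl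
  where open ℤ-Solver.+-*-Solver

-- The denominators xₙ

prodBelow : (ℕ → ℤ) → ℕ → ℤ
prodBelow f zero = + 1
prodBelow f (suc n) = f 0 * prodBelow (f ∘ suc) n

foldr-*-applyUpTo : ∀ f n → foldr _*_ (+ 1) (applyUpTo f n) ≡ prodBelow f n
foldr-*-applyUpTo f zero = refl
foldr-*-applyUpTo f (suc n) = cong (f 0 *_) (foldr-*-applyUpTo (f ∘ suc) n)

prodBelow-cong : ∀ n {f g} → (∀ i → i ℕ.< n → f i ≡ g i) → prodBelow f n ≡ prodBelow g n
prodBelow-cong zero f≗g = refl
prodBelow-cong (suc n) f≗g =
  cong₂ _*_ (f≗g 0 (s≤s z≤n)) (prodBelow-cong n (λ i i<n → f≗g (suc i) (s≤s i<n)))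

prodBelow-* : ∀ n f g → prodBelow (λ i → f i * g i) n ≡ prodBelow f n * prodBelow g n
prodBelow-* zero f g = refl
prodBelow-* (suc n) f g =
  trans (cong (f 0 * g 0 *_) (prodBelow-* n (f ∘ suc) (g ∘ suc))) (interchange (f 0) (g 0) _ _)
  where
    interchange : ∀ a b c d → a * b * (c * d) ≡ a * c * (b * d)
    interchange = solve-∀

prodBelow-snoc : ∀ n f → prodBelow f (suc n) ≡ prodBelow f n * f n
prodBelow-snoc zero f = trans (ℤP.*-identityʳ (f 0)) (sym (ℤP.*-identityˡ (f 0)))
prodBelow-snoc (suc n) f =
  trans (cong (f 0 *_) (prodBelow-snoc n (f ∘ suc))) (sym (ℤP.*-assoc (f 0) _ _))

x-prodBelow : ∀ z k → x z (suc (suc k)) ≡ prodBelow (λ i → z (2 ℕ.+ i) ℤ.^ (2 ℕ.^ (k ℕ.∸ i))) (suc k)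
x-prodBelow z k = trans
  (cong (foldr _*_ (+ 1)) (trans (cong (map F) (ListP.map-applyUpTo (λ i → i) (2 ℕ.+_) (suc k)))
                                 (ListP.map-applyUpTo (2 ℕ.+_) F (suc k))))
  (foldr-*-applyUpTo (F ∘ (2 ℕ.+_)) (suc k))
  where
    F : ℕ → ℤ
    F j = z j ℤ.^ (2 ℕ.^ (suc (suc k) ℕ.∸ j))

^-2^-suc : ∀ a e → a ℤ.^ (2 ℕ.^ suc e) ≡ a ℤ.^ (2 ℕ.^ e) * a ℤ.^ (2 ℕ.^ e)
^-2^-suc a e = trans (cong (a ℤ.^_) (cong (2 ℕ.^ e ℕ.+_) (ℕP.+-identityʳ (2 ℕ.^ e))))
                     (ℤP.^-distribˡ-+-* a (2 ℕ.^ e) (2 ℕ.^ e))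

x-suc : ∀ z k → x z (3 ℕ.+ k) ≡ z (3 ℕ.+ k) * x z (2 ℕ.+ k) * x z (2 ℕ.+ k)
x-suc z k = begin
  x z (3 ℕ.+ k)                              ≡⟨ x-prodBelow z (suc k) ⟩
  prodBelow (G (suc k)) (2 ℕ.+ k)            ≡⟨ prodBelow-snoc (suc k) (G (suc k)) ⟩
  prodBelow (G (suc k)) (suc k) * G (suc k) (suc k)
    ≡⟨ cong₂ _*_ (trans (prodBelow-cong (suc k) squares) (prodBelow-* (suc k) (G k) (G k)))
                 (cong (z (3 ℕ.+ k) ℤ.^_) (cong (2 ℕ.^_) (ℕP.n∸n≡0 k))) ⟩
  prodBelow (G k) (suc k) * prodBelow (G k) (suc k) * (z (3 ℕ.+ k) * + 1)
    ≡⟨ rearrange (prodBelow (G k) (suc k)) (z (3 ℕ.+ k)) ⟩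
  z (3 ℕ.+ k) * prodBelow (G k) (suc k) * prodBelow (G k) (suc k)
    ≡⟨ cong (λ w → z (3 ℕ.+ k) * w * w) (x-prodBelow z k) ⟨
  z (3 ℕ.+ k) * x z (2 ℕ.+ k) * x z (2 ℕ.+ k) ∎
  where
    open ≡-Reasoning
    G : ℕ → ℕ → ℤ
    G k i = z (2 ℕ.+ i) ℤ.^ (2 ℕ.^ (k ℕ.∸ i))
    squares : ∀ i → i ℕ.< suc k → G (suc k) i ≡ G k i * G k i
    squares i i<k = trans (cong (λ e → z (2 ℕ.+ i) ℤ.^ (2 ℕ.^ e)) (ℕP.+-∸-assoc 1 (ℕP.≤-pred i<k)))
                          (^-2^-suc (z (2 ℕ.+ i)) (k ℕ.∸ i))
    rearrange : ∀ p w → p * p * (w * + 1) ≡ w * p * p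
    rearrange = solve-∀

square-growth : ∀ {X q} n → + 2 ≤ X → + suc n ≤ q → + suc (suc n) ≤ X * q * q
square-growth {X} {q} n 2≤X 1+n≤q = begin
  + suc (suc n)     ≡⟨ cong +_ (ℕP.+-comm 1 (suc n)) ⟩
  + suc n + + 1     ≤⟨ ℤP.+-mono-≤ 1+n≤q 1≤q ⟩
  q + q             ≡⟨ double q ⟩
  + 2 * q           ≤⟨ ℤP.*-monoʳ-≤-nonNeg q {{ℤ.nonNegative 0≤q}} 2≤X ⟩
  X * q             ≡⟨ ℤP.*-identityʳ (X * q) ⟨
  X * q * + 1       ≤⟨ ℤP.*-monoˡ-≤-nonNeg (X * q) {{ℤ.nonNegative 0≤Xq}} 1≤q ⟩
  X * q * q         ∎
  where
    open ℤP.≤-Reasoning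
    double : ∀ q → q + q ≡ + 2 * q
    double = solve-∀
    1≤q = ℤP.≤-trans (ℤ.+≤+ (s≤s z≤n)) 1+n≤q
    0≤q = ℤP.≤-trans (ℤ.+≤+ z≤n) 1≤q
    0≤Xq = nonNeg-* (ℤP.≤-trans (ℤ.+≤+ z≤n) 2≤X) 0≤q

module Construction (z : ℕ → ℤ) (z₂≥3 : + 3 ≤ z 2) (z≥2 : ∀ n → 3 ℕ.≤ n → + 2 ≤ z n) where

  x₂≡z₂ : x z 2 ≡ z 2
  x₂≡z₂ = times-one² (z 2)
    where
      times-one² : ∀ a → a * + 1 * + 1 ≡ a
      times-one² = solve-∀

  x-≥ : ∀ k → + suc k ≤ x z (2 ℕ.+ k)
  x-≥ zero = subst (+ 1 ≤_) (sym x₂≡z₂) (ℤP.≤-trans (ℤ.+≤+ (s≤s z≤n)) z₂≥3)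
  x-≥ (suc k) = subst (+ suc (suc k) ≤_) (sym (x-suc z k))
    (square-growth k (z≥2 (3 ℕ.+ k) (ℕP.m≤m+n 3 k)) (x-≥ k))

  x≢0 : ∀ k → x z (2 ℕ.+ k) ≢ + 0
  x≢0 k = pos⇒≢0 (1≤⇒pos (ℤP.≤-trans (ℤ.+≤+ (s≤s z≤n)) (x-≥ k)))

  record Invariant (k : ℕ) : Set where
    field
      positive : PositiveBelow (len k) (A z k)
      last≥2   : + 2 ≤ A z k (len k ℕ.∸ 1)
      first≡1  : A z k 0 ≡ + 1
      second   : A z k 1 ≡ z 2 ℤ.- + 1
      m21≡x    : m21 (cfMatrix (A z k) (len k)) ≡ x z (3 ℕ.+ k)
      det≡-1   : det (cfMatrix (A z k) (len k)) ≡ - + 1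
      value    : frac (m11 (cfMatrix (A z k) (len k))) (m21 (cfMatrix (A z k) (len k))) ≡ partialSum z (3 ℕ.+ k)
  open Invariant

  z₂≢0 : z 2 ≢ + 0
  z₂≢0 = pos⇒≢0 (1≤⇒pos (ℤP.≤-trans (ℤ.+≤+ (s≤s z≤n)) z₂≥3))

  x₃ : x z 3 ≡ z 3 * z 2 * z 2
  x₃ = trans (x-suc z 0) (cong (λ w → z 3 * w * w) x₂≡z₂)

  partialSum₂ : frac (z 2 + + 1) (z 2) ≡ partialSum z 2
  partialSum₂ = begin
    frac (z 2 + + 1) (z 2)                   ≡⟨ cong (λ t → frac (t + + 1) (z 2)) (ℤP.*-identityˡ (z 2)) ⟨
    frac (+ 1 * z 2 + + 1) (z 2)             ≡⟨ toℚ-+-frac (+ 1) (+ 1) z₂≢0 ⟨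
    toℚ (+ 1) ℚ.+ frac (+ 1) (z 2)           ≡⟨ cong₂ ℚ._+_ (frac-one (+ 1)) (cong (frac (+ 1)) x₂≡z₂) ⟨
    frac (+ 1) (+ 1) ℚ.+ frac (+ 1) (x z 2)  ≡⟨ cong₂ ℚ._+_ (trans (recip-toℚ (+ 1)) (sym (ℚP.+-identityˡ _))) (recip-toℚ (x z 2)) ⟨
    (0ℚ ℚ.+ recip (toℚ (+ 1))) ℚ.+ recip (toℚ (x z 2)) ∎
    where open ≡-Reasoning

  partialSum₃ : frac (z 3 * (z 2 + + 1) * z 2 + + 1) (z 3 * z 2 * z 2) ≡ partialSum z 3
  partialSum₃ = begin
    frac (z 3 * (z 2 + + 1) * z 2 + + 1) (z 3 * z 2 * z 2)
      ≡⟨ frac-step (z 3) (z 2 + + 1) (z 2) z₂≢0 (subst (_≢ + 0) x₃ (x≢0 1)) ⟩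
    frac (z 2 + + 1) (z 2) ℚ.+ frac (+ 1) (z 3 * z 2 * z 2)
      ≡⟨ cong₂ ℚ._+_ partialSum₂ (trans (cong (frac (+ 1)) (sym x₃)) (sym (recip-toℚ (x z 3)))) ⟩
    partialSum z 3 ∎
    where open ≡-Reasoning

  invariant-base : Invariant 0
  invariant-base = record
    { positive = positive₀
    ; last≥2   = ℤP.≤-trans (ℤ.+≤+ (s≤s (s≤s z≤n))) z₂≥3
    ; first≡1  = refl
    ; second   = refl
    ; m21≡x    = trans (initial-m21 (z 2) (z 3)) (sym x₃)
    ; det≡-1   = initial-det (z 2) (z 3)
    ; value    = trans (cong₂ frac (initial-m11 (z 2) (z 3)) (initial-m21 (z 2) (z 3))) partialSum₃
    }
    where
      positive₀ : PositiveBelow 5 (base z)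
      positive₀ 0 _ = ℤP.≤-refl
      positive₀ 1 _ = ℤP.≤-trans (ℤ.+≤+ (s≤s z≤n)) (-1-mono-≤ (ℤP.≤-trans (ℤ.+≤+ (s≤s (s≤s z≤n))) z₂≥3))
      positive₀ 2 _ = ℤP.≤-refl
      positive₀ 3 _ = -1-mono-≤ (z≥2 3 ℕP.≤-refl)
      positive₀ 4 _ = ℤP.≤-trans (ℤ.+≤+ (s≤s z≤n)) z₂≥3
      positive₀ (suc (suc (suc (suc (suc _))))) (s≤s (s≤s (s≤s (s≤s (s≤s ())))))

  module Step (k : ℕ) (inv : Invariant k) where
    private
      L = len k
      g = A z k
      h = A z (suc k)
      X = z (suc (k ℕ.+ 3))
      W = cfMatrix (g ∘ suc) (L ℕ.∸ 2)
      l = g (L ℕ.∸ 1)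
      F = folded W l
      N = cfMatrix h (len (suc k))

      3≤L : 3 ℕ.≤ L
      3≤L = ℕP.≤-trans (ℕP.m≤n+m 3 k) (len-≥ k)

      old : cfMatrix g L ≡ F
      old = cfMatrix-fold g L 3≤L (first≡1 inv)

      new : N ≡ unfolded W l X
      new = trans (cong (cfMatrix h) (len-suc k))
        (cfMatrix-unfold g h L X 3≤L (first≡1 inv) (A-suc-below z k) (A-suc-at-len z k)
          (A-suc-at-1+len z k) (A-suc-at-2+len z k) (A-suc-mirror z k))

      det-F : det F ≡ - + 1
      det-F = trans (cong det (sym old)) (det≡-1 inv)

      q≡x : m21 F ≡ x z (3 ℕ.+ k)
      q≡x = trans (cong m21 (sym old)) (m21≡x inv)

      X≥2 : + 2 ≤ X
      X≥2 = z≥2 (suc (k ℕ.+ 3)) (ℕP.≤-trans (ℕP.m≤n+m 3 k) (ℕP.n≤1+n _))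

      Xq²≡x : X * m21 F * m21 F ≡ x z (4 ℕ.+ k)
      Xq²≡x = begin
        X * m21 F * m21 F                        ≡⟨ cong (λ w → X * w * w) q≡x ⟩
        X * x z (3 ℕ.+ k) * x z (3 ℕ.+ k)        ≡⟨ cong (λ n → z (suc n) * x z (3 ℕ.+ k) * x z (3 ℕ.+ k)) (ℕP.+-comm k 3) ⟩
        z (4 ℕ.+ k) * x z (3 ℕ.+ k) * x z (3 ℕ.+ k) ≡⟨ x-suc z (suc k) ⟨
        x z (4 ℕ.+ k)                            ∎
        where open ≡-Reasoning

    first : h 0 ≡ + 1
    first = trans (A-suc-below z k 0 (ℕP.≤-trans (s≤s z≤n) 3≤L)) (first≡1 inv)

    second′ : h 1 ≡ z 2 ℤ.- + 1
    second′ = trans (A-suc-below z k 1 (ℕP.≤-trans (s≤s (s≤s z≤n)) 3≤L)) (second inv)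

    last : h (len (suc k) ℕ.∸ 1) ≡ z 2 ℤ.- + 1
    last = begin
      h (len (suc k) ℕ.∸ 1)   ≡⟨ cong (λ n → h (n ℕ.∸ 1)) (trans (len-suc k) (ℕP.+-suc L L)) ⟩
      h (L ℕ.+ L)             ≡⟨ A-suc-mirror z k L 3≤L ℕP.≤-refl ⟩
      g (suc L ℕ.∸ L)         ≡⟨ cong g (ℕP.m+n∸n≡m 1 L) ⟩
      g 1                     ≡⟨ second inv ⟩
      z 2 ℤ.- + 1             ∎
      where open ≡-Reasoning

    positive-appended : ∀ t → t ℕ.≤ L → + 1 ≤ h (L ℕ.+ t)
    positive-appended 0 _ =
      subst (+ 1 ≤_) (sym (trans (cong h (ℕP.+-identityʳ L)) (A-suc-at-len z k))) (-1-mono-≤ X≥2)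
    positive-appended 1 _ =
      subst (+ 1 ≤_) (sym (trans (cong h (ℕP.+-comm L 1)) (A-suc-at-1+len z k))) ℤP.≤-refl
    positive-appended 2 _ =
      subst (+ 1 ≤_) (sym (trans (cong h (ℕP.+-comm L 2)) (A-suc-at-2+len z k))) (-1-mono-≤ (last≥2 inv))
    positive-appended t@(suc (suc (suc _))) t≤L =
      subst (+ 1 ≤_) (sym (A-suc-mirror z k t (s≤s (s≤s (s≤s z≤n))) t≤L))
        (positive inv _ (ℕP.∸-monoʳ-< {o = 0} (s≤s z≤n) (ℕP.≤-trans (ℕP.n≤1+n _) t≤L)))

    positive′ : PositiveBelow (len (suc k)) h
    positive′ j j<len with j ℕ.<? L
    ... | yes j<L = subst (+ 1 ≤_) (sym (A-suc-below z k j j<L)) (positive inv j j<L)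
    ... | no j≮L = subst (λ i → + 1 ≤ h i) (ℕP.m+[n∸m]≡n L≤j)
            (positive-appended (j ℕ.∸ L) (ℕP.≤-pred (ℕP.+-cancelˡ-< L (j ℕ.∸ L) (suc L)
              (subst₂ ℕ._<_ (sym (ℕP.m+[n∸m]≡n L≤j)) (len-suc k) j<len))))
      where L≤j = ℕP.≮⇒≥ j≮L

    m21-N : m21 N ≡ x z (4 ℕ.+ k)
    m21-N = trans (cong m21 new) (trans (unfolded-m21 W l X) Xq²≡x)

    det-N : det N ≡ - + 1
    det-N = trans (cong det new) (trans (unfolded-det W l X) (cong (λ d → - (d * d)) det-F))

    value-N : frac (m11 N) (m21 N) ≡ partialSum z (4 ℕ.+ k)
    value-N = begin
      frac (m11 N) (m21 N)
        ≡⟨ cong₂ frac (trans (cong m11 new) (unfolded-m11 W l X)) (trans (cong m21 new) (unfolded-m21 W l X)) ⟩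
      frac (X * m11 F * m21 F + - det F) (X * m21 F * m21 F)
        ≡⟨ cong (λ d → frac (X * m11 F * m21 F + - d) (X * m21 F * m21 F)) det-F ⟩
      frac (X * m11 F * m21 F + + 1) (X * m21 F * m21 F)
        ≡⟨ frac-step X (m11 F) (m21 F) (subst (_≢ + 0) (sym q≡x) (x≢0 (suc k)))
                                       (subst (_≢ + 0) (sym Xq²≡x) (x≢0 (2 ℕ.+ k))) ⟩
      frac (m11 F) (m21 F) ℚ.+ frac (+ 1) (X * m21 F * m21 F)
        ≡⟨ cong₂ ℚ._+_ (trans (cong (λ B → frac (m11 B) (m21 B)) (sym old)) (value inv))
                       (trans (cong (frac (+ 1)) Xq²≡x) (sym (recip-toℚ (x z (4 ℕ.+ k))))) ⟩
      partialSum z (4 ℕ.+ k) ∎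
      where open ≡-Reasoning

  invariant-suc : ∀ k → Invariant k → Invariant (suc k)
  invariant-suc k inv = record
    { positive = positive′
    ; last≥2   = subst (+ 2 ≤_) (sym last) (-1-mono-≤ z₂≥3)
    ; first≡1  = first
    ; second   = second′
    ; m21≡x    = m21-N
    ; det≡-1   = det-N
    ; value    = value-N
    }
    where open Step k inv

  invariant : ∀ k → Invariant k
  invariant zero = invariant-base
  invariant (suc k) = invariant-suc k (invariant k)

  x²-> : ∀ k → + k < x z (3 ℕ.+ k) * x z (3 ℕ.+ k)
  x²-> k = ℤP.<-≤-trans (ℤ.+<+ (ℕP.≤-trans (ℕP.n<1+n k) (ℕP.n≤1+n _)))
    (ℤP.≤-trans (x-≥ (suc k)) (≤-*ˡ 1≤x (ℤP.≤-trans (ℤ.+≤+ z≤n) 1≤x)))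
    where 1≤x = ℤP.≤-trans (ℤ.+≤+ (s≤s z≤n)) (x-≥ (suc k))

  1≤len : ∀ k → 1 ℕ.≤ len k
  1≤len k = ℕP.≤-trans (s≤s z≤n) (ℕP.≤-trans (ℕP.m≤n+m 3 k) (len-≥ k))

  cfEval-A : ∀ k → cfEval (applyUpTo (A z k) (len k)) ≡ partialSum z (3 ℕ.+ k)
  cfEval-A k = trans (cfEval-cfMatrix (len k) (A z k) (1≤len k) (positive (invariant k))) (value (invariant k))

  prefix-gap : ∀ K n f → (∀ i → i ℕ.< len K → f i ≡ A z K i) → len K ℕ.≤ n → PositiveBelow n f →
    ℚ.∣ cfEval (applyUpTo f n) ℚ.- partialSum z (3 ℕ.+ K) ∣ ℚ.≤ frac (+ 1) (x z (3 ℕ.+ K) * x z (3 ℕ.+ K))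
  prefix-gap K n f agree len≤n pos =
    subst₂ (λ S q → ℚ.∣ cfEval (applyUpTo f n) ℚ.- S ∣ ℚ.≤ frac (+ 1) (q * q))
      (trans (cong cfEval (applyUpTo-cong (len K) agree)) (cfEval-A K))
      (trans (cong m21 (cfMatrix-cong (len K) agree)) (m21≡x (invariant K)))
      (cfEval-gap (len K) n f (1≤len K) len≤n pos)

  partialSum-gap : ∀ K m → len K ℕ.≤ m →
    ℚ.∣ partialSum z m ℚ.- partialSum z (3 ℕ.+ K) ∣ ℚ.≤ frac (+ 1) (x z (3 ℕ.+ K) * x z (3 ℕ.+ K))
  partialSum-gap K m len≤m =
    subst (λ S → ℚ.∣ S ℚ.- partialSum z (3 ℕ.+ K) ∣ ℚ.≤ _) (trans (cfEval-A k) (cong (partialSum z) m≡))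
      (prefix-gap K (len k) (A z k) agree (subst (λ k → len K ℕ.≤ len k) k≡ (len-≤-+ (k ℕ.∸ K) K))
        (positive (invariant k)))
    where
      K+3≤m = ℕP.≤-trans (len-≥ K) len≤m
      3≤m = ℕP.≤-trans (ℕP.m≤n+m 3 K) K+3≤m
      k = m ℕ.∸ 3
      m≡ : 3 ℕ.+ k ≡ m
      m≡ = ℕP.m+[n∸m]≡n 3≤m
      K≤k : K ℕ.≤ k
      K≤k = ℕP.+-cancelʳ-≤ 3 K k (subst (K ℕ.+ 3 ℕ.≤_) (trans (sym m≡) (ℕP.+-comm 3 k)) K+3≤m)
      k≡ : k ℕ.∸ K ℕ.+ K ≡ k
      k≡ = ℕP.m∸n+n≡m K≤k
      agree : ∀ i → i ℕ.< len K → A z k i ≡ A z K i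
      agree i i<len = trans (cong (λ k → A z k i) (sym k≡)) (A-stable z (k ℕ.∸ K) K i i<len)

  module Limit (a : ℕ → ℤ) (a-limit : ∀ j → ∃[ N ] (∀ n → N ℕ.≤ n → 3 ℕ.≤ n → aSeq z n j ≡ a j)) where

    a≡A : ∀ k j → j ℕ.< len k → a j ≡ A z k j
    a≡A k j j<len =
      trans (sym (proj₂ (a-limit j) n (ℕP.≤-trans (ℕP.m≤m+n N k) (ℕP.m≤m+n (N ℕ.+ k) 3)) (ℕP.m≤n+m 3 (N ℕ.+ k))))
            (trans (cong (λ m → A z m j) (ℕP.m+n∸n≡m (N ℕ.+ k) 3)) (A-stable z N k j j<len))
      where
        N = proj₁ (a-limit j)
        n = N ℕ.+ k ℕ.+ 3

    a-positive : ∀ j → + 1 ≤ a j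
    a-positive j = subst (+ 1 ≤_) (sym (a≡A j j j<len)) (positive (invariant j) j j<len)
      where j<len = ℕP.≤-trans (ℕP.m<m+n j {3} (s≤s z≤n)) (len-≥ j)

    convergent-gap : ∀ K n → len K ℕ.≤ n →
      ℚ.∣ convergent a n ℚ.- partialSum z (3 ℕ.+ K) ∣ ℚ.≤ frac (+ 1) (x z (3 ℕ.+ K) * x z (3 ℕ.+ K))
    convergent-gap K n len≤n =
      subst (λ c → ℚ.∣ c ℚ.- partialSum z (3 ℕ.+ K) ∣ ℚ.≤ _)
        (cong cfEval (sym (ListP.map-applyUpTo (λ i → i) a (suc n))))
        (prefix-gap K (suc n) a (a≡A K) (ℕP.≤-trans len≤n (ℕP.n≤1+n n)) (λ i _ → a-positive i))

theorem2 : (z : ℕ → ℤ) → + 3 ℤ.≤ z 2 → (∀ n → 3 ℕ.≤ n → + 2 ℤ.≤ z n) →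
    (a : ℕ → ℤ) →
    (∀ j → ∃[ N ] (∀ n → N ℕ.≤ n → 3 ℕ.≤ n → aSeq z n j ≡ a j)) →
    ∀ (ε : ℚ) → 0ℚ ℚ.< ε →
      ∃[ N ] (∀ m n → N ℕ.≤ m → N ℕ.≤ n →
        ℚ.∣ partialSum z m ℚ.- convergent a n ∣ ℚ.< ε)
theorem2 z z₂≥3 z≥2 a a-limit ε 0<ε = len K , close
  where
    open Construction z z₂≥3 z≥2
    open Limit a a-limit
    open ℚP.≤-Reasoning
    -- 2/Q < ε as soon as Q > 2·↧ε, and x_{3+K}² > K
    K = 2 ℕ.* ℚ.↧ₙ ε
    S = partialSum z (3 ℕ.+ K)
    Q = x z (3 ℕ.+ K) * x z (3 ℕ.+ K)
    close : ∀ m n → len K ℕ.≤ m → len K ℕ.≤ n → ℚ.∣ partialSum z m ℚ.- convergent a n ∣ ℚ.< ε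
    close m n len≤m len≤n = begin-strict
      ℚ.∣ partialSum z m ℚ.- convergent a n ∣              ≤⟨ ∣-∣-triangle (partialSum z m) (convergent a n) S ⟩
      ℚ.∣ partialSum z m ℚ.- S ∣ ℚ.+ ℚ.∣ convergent a n ℚ.- S ∣
        ≤⟨ ℚP.+-mono-≤ (partialSum-gap K m len≤m) (convergent-gap K n len≤n) ⟩
      frac (+ 1) Q ℚ.+ frac (+ 1) Q                        <⟨ two-fracs-< ε 0<ε Q (subst (_< Q) (ℤP.pos-* 2 (ℚ.↧ₙ ε)) (x²-> K)) ⟩
      ε                                                    ∎
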